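{- Let $f(x,y)=ux^2+vxy+wy^2\in\mathbb{Q}[x,y]$ be a nonzero quadratic form with $u,v,w\in\mathbb{Q}$. Then there are infinitely many pairs $(a,Q)$ of rational numbers with $aQ(Q^2-1)\neq 0$ such that $\mathcal{G}(a,Q)\subset\mathcal{V}_{f}$.
   Context: For $a,Q\in\mathbb{Q}$ with $aQ(Q^2-1)\neq 0$, $\mathcal{G}(a,Q)=\{aQ^{i}:\ i\in\mathbb{N}\}$, where $\mathbb{N}=\{0,1,2,\dots\}$. For $f\in\mathbb{Q}(x,y)$, $\mathcal{V}_{f}=\{f(u,v):\ u,v\in\mathbb{Q}\text{ such that }f(u,v)\text{ is defined}\}$. -}

module Defs where

open import Data.Nat using (ℕ; zero; suc)
open import Data.Rational using (ℚ; _+_; _*_; _-_; 0ℚ; 1ℚ)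
open import Data.Product using (∃₂)
open import Relation.Binary.PropositionalEquality using (_≡_; _≢_)

infixr 8 _^_
_^_ : ℚ → ℕ → ℚ
q ^ zero  = 1ℚ
q ^ suc n = q * (q ^ n)

quadForm : ℚ → ℚ → ℚ → ℚ → ℚ → ℚ
quadForm u v w x y = u * (x * x) + v * (x * y) + w * (y * y)

InValues : ℚ → ℚ → ℚ → ℚ → Set
InValues u v w z = ∃₂ λ x y → quadForm u v w x y ≡ z

GeomInValues : ℚ → ℚ → ℚ → ℚ → ℚ → Set
GeomInValues u v w a Q = ∀ (i : ℕ) → InValues u v w (a * (Q ^ i))

Admissible : ℚ → ℚ → Set
Admissible a Q = a * Q * (Q ^ 2 - 1ℚ) ≢ 0ℚ

{-# OPTIONS --safe #-}
-- Pick (x₀, y₀) with a = f(x₀, y₀) ≠ 0. Since f is homogeneous of degree 2,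
-- f(tⁱ x₀, tⁱ y₀) = a (t²)ⁱ, so every pair (a, t²) with t ∉ {0, ±1} works;
-- t = n + 2 gives infinitely many of them.
module Submission where

open import Defs
open import Data.Nat using (ℕ; zero; suc)
import Data.Nat.Properties as ℕ
open import Data.Rational using (ℚ; 0ℚ; 1ℚ; _+_; _*_; _-_; 1/_; ≢-nonZero; Positive; NonNegative)
open import Data.Rational.Properties
open import Data.Rational.Solver using (module +-*-Solver)
open import Algebra.Properties.Group +-0-group using (x∙y⁻¹≈ε⇒x≈y; ∙-cancelˡ)
open import Data.Empty using (⊥-elim)
open import Data.Product using (Σ; _×_; _,_; proj₁; proj₂)
open import Data.Sum using (_⊎_; inj₁; inj₂; [_,_]′)
open import Function.Base using (_∘_)
open import Function.Definitions using (Injective)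
open import Relation.Nullary using (¬_; yes; no; contradiction)
open import Relation.Binary.PropositionalEquality
  using (_≡_; _≢_; refl; sym; trans; cong; module ≡-Reasoning)

open +-*-Solver

p*q≡0⇒p≡0∨q≡0 : ∀ p q → p * q ≡ 0ℚ → p ≡ 0ℚ ⊎ q ≡ 0ℚ
p*q≡0⇒p≡0∨q≡0 p q pq≡0 with p ≟ 0ℚ
... | yes p≡0 = inj₁ p≡0
... | no p≢0 = inj₂ (begin
    q               ≡⟨ sym (*-identityˡ q) ⟩
    1ℚ * q          ≡⟨ cong (_* q) (sym (*-inverseˡ p)) ⟩
    (1/ p * p) * q  ≡⟨ *-assoc (1/ p) p q ⟩
    1/ p * (p * q)  ≡⟨ cong (1/ p *_) pq≡0 ⟩
    1/ p * 0ℚ       ≡⟨ *-zeroʳ (1/ p) ⟩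
    0ℚ              ∎)
  where
  open ≡-Reasoning
  instance _ = ≢-nonZero p≢0

*-≢0 : ∀ {p q} → p ≢ 0ℚ → q ≢ 0ℚ → p * q ≢ 0ℚ
*-≢0 {p} {q} p≢0 q≢0 pq≡0 with p*q≡0⇒p≡0∨q≡0 p q pq≡0
... | inj₁ p≡0 = p≢0 p≡0
... | inj₂ q≡0 = q≢0 q≡0

pos⇒≢0 : ∀ p → .{{Positive p}} → p ≢ 0ℚ
pos⇒≢0 p p≡0 = <⇒≢ (positive⁻¹ p) (sym p≡0)

difference-of-squares : ∀ p q → (p - q) * (p + q) ≡ p * p - q * q
difference-of-squares = solve 2 (λ p q → (p :- q) :* (p :+ q) := p :* p :- q :* q) refl

p*p≡q*q⇒p≡q : ∀ p q → .{{Positive p}} → .{{Positive q}} → p * p ≡ q * q → p ≡ q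
p*p≡q*q⇒p≡q p q pp≡qq = [ x∙y⁻¹≈ε⇒x≈y p q , ⊥-elim ∘ p+q≢0 ]′
  (p*q≡0⇒p≡0∨q≡0 (p - q) (p + q) (begin
    (p - q) * (p + q)  ≡⟨ difference-of-squares p q ⟩
    p * p - q * q      ≡⟨ cong (_- q * q) pp≡qq ⟩
    q * q - q * q      ≡⟨ +-inverseʳ (q * q) ⟩
    0ℚ                 ∎))
  where
  open ≡-Reasoning
  p+q≢0 : p + q ≢ 0ℚ
  p+q≢0 = pos⇒≢0 (p + q) {{pos+pos⇒pos p q}}

fromℕ : ℕ → ℚ
fromℕ zero    = 0ℚ
fromℕ (suc n) = 1ℚ + fromℕ n

fromℕ-nonNeg : ∀ n → NonNegative (fromℕ n)
fromℕ-nonNeg zero    = _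
fromℕ-nonNeg (suc n) = nonNeg+nonNeg⇒nonNeg 1ℚ (fromℕ n) {{fromℕ-nonNeg n}}

fromℕ-suc-pos : ∀ n → Positive (fromℕ (suc n))
fromℕ-suc-pos n = pos+nonNeg⇒pos 1ℚ (fromℕ n) {{fromℕ-nonNeg n}}

fromℕ-injective : Injective _≡_ _≡_ fromℕ
fromℕ-injective {zero}  {zero}  _  = refl
fromℕ-injective {zero}  {suc n} eq = contradiction (sym eq) (pos⇒≢0 (fromℕ (suc n)) {{fromℕ-suc-pos n}})
fromℕ-injective {suc m} {zero}  eq = contradiction eq (pos⇒≢0 (fromℕ (suc m)) {{fromℕ-suc-pos m}})
fromℕ-injective {suc m} {suc n} eq = cong suc (fromℕ-injective (∙-cancelˡ 1ℚ (fromℕ m) (fromℕ n) eq))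

quadForm-homogeneous : ∀ u v w x y r → quadForm u v w (r * x) (r * y) ≡ (r * r) * quadForm u v w x y
quadForm-homogeneous = solve 6 (λ u v w x y r →
  u :* ((r :* x) :* (r :* x)) :+ v :* ((r :* x) :* (r :* y)) :+ w :* ((r :* y) :* (r :* y))
    := (r :* r) :* (u :* (x :* x) :+ v :* (x :* y) :+ w :* (y :* y))) refl

^-square : ∀ t i → (t * t) ^ i ≡ t ^ i * t ^ i
^-square t zero    = sym (*-identityˡ 1ℚ)
^-square t (suc i) = begin
  (t * t) * (t * t) ^ i        ≡⟨ cong ((t * t) *_) (^-square t i) ⟩
  (t * t) * (t ^ i * t ^ i)    ≡⟨ solve 2 (λ t p → (t :* t) :* (p :* p) := (t :* p) :* (t :* p)) refl t (t ^ i) ⟩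
  t * t ^ i * (t * t ^ i)      ∎
  where open ≡-Reasoning

geomInValues-square : ∀ u v w x y t → GeomInValues u v w (quadForm u v w x y) (t * t)
geomInValues-square u v w x y t i = tⁱ * x , tⁱ * y , (begin
  quadForm u v w (tⁱ * x) (tⁱ * y)  ≡⟨ quadForm-homogeneous u v w x y tⁱ ⟩
  (tⁱ * tⁱ) * quadForm u v w x y    ≡⟨ *-comm (tⁱ * tⁱ) _ ⟩
  quadForm u v w x y * (tⁱ * tⁱ)    ≡⟨ cong (quadForm u v w x y *_) (sym (^-square t i)) ⟩
  quadForm u v w x y * (t * t) ^ i  ∎)
  where
  open ≡-Reasoning
  tⁱ : ℚ
  tⁱ = t ^ i

admissible-square : ∀ a t → .{{Positive t}} → a ≢ 0ℚ → t ≢ 1ℚ → Admissible a (t * t)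
admissible-square a t a≢0 t≢1 =
  *-≢0 (*-≢0 a≢0 (pos⇒≢0 (t * t) {{tt-pos}})) [tt]²-1≢0
  where
  tt-pos : Positive (t * t)
  tt-pos = pos*pos⇒pos t t
  [tt]²-1≢0 : (t * t) ^ 2 - 1ℚ ≢ 0ℚ
  [tt]²-1≢0 eq = t≢1 (p*p≡q*q⇒p≡q t 1ℚ (p*p≡q*q⇒p≡q (t * t) 1ℚ {{tt-pos}} (begin
    (t * t) * (t * t)  ≡⟨ cong ((t * t) *_) (sym (*-identityʳ (t * t))) ⟩
    (t * t) ^ 2        ≡⟨ x∙y⁻¹≈ε⇒x≈y _ 1ℚ eq ⟩
    1ℚ                 ∎)))
    where open ≡-Reasoning

nonzero-value : ∀ u v w → ¬ (u ≡ 0ℚ × v ≡ 0ℚ × w ≡ 0ℚ) →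
  Σ (ℚ × ℚ) λ (x , y) → quadForm u v w x y ≢ 0ℚ
nonzero-value u v w nz with u ≟ 0ℚ | w ≟ 0ℚ
... | no u≢0    | _       = (1ℚ , 0ℚ) , λ eq → u≢0 (trans (sym (f[1,0] u v w)) eq)
  where
  f[1,0] : ∀ u v w → quadForm u v w 1ℚ 0ℚ ≡ u
  f[1,0] = solve 3 (λ u v w →
    u :* (con 1ℚ :* con 1ℚ) :+ v :* (con 1ℚ :* con 0ℚ) :+ w :* (con 0ℚ :* con 0ℚ) := u) refl
... | yes _     | no w≢0  = (0ℚ , 1ℚ) , λ eq → w≢0 (trans (sym (f[0,1] u v w)) eq)
  where
  f[0,1] : ∀ u v w → quadForm u v w 0ℚ 1ℚ ≡ w
  f[0,1] = solve 3 (λ u v w →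
    u :* (con 0ℚ :* con 0ℚ) :+ v :* (con 0ℚ :* con 1ℚ) :+ w :* (con 1ℚ :* con 1ℚ) := w) refl
... | yes refl  | yes refl = (1ℚ , 1ℚ) , λ eq → nz (refl , trans (sym (f[1,1] v)) eq , refl)
  where
  f[1,1] : ∀ v → quadForm 0ℚ v 0ℚ 1ℚ 1ℚ ≡ v
  f[1,1] = solve 1 (λ v →
    con 0ℚ :* (con 1ℚ :* con 1ℚ) :+ v :* (con 1ℚ :* con 1ℚ) :+ con 0ℚ :* (con 1ℚ :* con 1ℚ) := v) refl

theorem2p2 : (u v w : ℚ) → ¬ (u ≡ 0ℚ × v ≡ 0ℚ × w ≡ 0ℚ) →
    Σ (ℕ → ℚ × ℚ) λ g → Injective _≡_ _≡_ g ×
      ((n : ℕ) → Admissible (proj₁ (g n)) (proj₂ (g n)) × GeomInValues u v w (proj₁ (g n)) (proj₂ (g n)))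
theorem2p2 u v w nz with nonzero-value u v w nz
... | (x₀ , y₀) , a≢0 = g , g-injective , λ n →
    admissible-square a (t n) {{t-pos n}} a≢0 (t≢1 n) , geomInValues-square u v w x₀ y₀ (t n)
  where
  a : ℚ
  a = quadForm u v w x₀ y₀
  t : ℕ → ℚ
  t n = fromℕ (suc (suc n))
  t-pos : ∀ n → Positive (t n)
  t-pos n = fromℕ-suc-pos (suc n)
  t≢1 : ∀ n → t n ≢ 1ℚ
  t≢1 n eq with fromℕ-injective {suc (suc n)} {1} (trans eq (sym (+-identityʳ 1ℚ)))
  ... | ()
  g : ℕ → ℚ × ℚ
  g n = a , t n * t n
  g-injective : Injective _≡_ _≡_ g
  g-injective {m} {n} eq = ℕ.suc-injective (ℕ.suc-injective (fromℕ-injective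
    (p*p≡q*q⇒p≡q (t m) (t n) {{t-pos m}} {{t-pos n}} (cong proj₂ eq))))
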